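{- Let $b \in \mathbb{Z}\setminus\{ -1,0,1\}$. Every $b$-LD-semigroup is a numerical monoid.
   Context: Fix $b \in \mathbb{Z}\setminus\{ -1,0,1\}$ and let $N_b := \{0,1,\dots,|b|-1\}$. Put $Z_b := \mathbb{N}\setminus\{0\}$ if $b>0$ and $Z_b := \mathbb{Z}\setminus\{0\}$ if $b<0$ (here $\mathbb{N}=\{0,1,2,\dots\}$). Every $z \in Z_b$ has a unique representation $z=\sum_{i=0}^{n} u_i b^i$ with $u_0,\dots,u_n \in N_b$, $u_n \neq 0$; its length is $\ell_b(z) := n+1$, and $\ell_b(0):=1$. For $n \ge 1$ let $\Delta_b(n) := \{z \in Z_b : \ell_b(z)=n\}$. For $A \subseteq Z_b$ let $L_b(A) := \{\ell_b(a) : a \in A\}$. A $b$-digital semigroup is a (nonempty) subsemigroup $D$ of the multiplicative semigroup $(Z_b,\cdot)$ such that $\Delta_b(\ell_b(d)) \subseteq D$ for every $d \in D$. A submonoid $S$ of $(\mathbb{N},+)$ is called a $b$-LD-semigroup if there exists a $b$-digital semigroup $D$ with $S = L_b(D)\cup\{0\}$. A numerical monoid is a submonoid of $(\mathbb{N},+)$ whose complement in $\mathbb{N}$ is finite. -}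

module Defs where

open import Level using (0ℓ)
open import Data.Nat as ℕ using (ℕ; zero; suc)
open import Data.Integer as ℤ using (ℤ; +_; ∣_∣)
open import Data.List using (List; []; _∷_; _∷ʳ_; length)
open import Data.List.Relation.Unary.All using (All)
open import Data.Product using (Σ; ∃; ∃-syntax; _×_)
open import Data.Sum using (_⊎_)
open import Relation.Binary.PropositionalEquality using (_≡_; _≢_)
open import Relation.Nullary using (¬_)

evalDigits : ℤ → List ℕ → ℤ
evalDigits b []       = + 0
evalDigits b (u ∷ us) = + u ℤ.+ b ℤ.* evalDigits b us

InZ : ℤ → ℤ → Set
InZ b z = (ℤ.+0 ℤ.< b → ℤ.+0 ℤ.< z) × (b ℤ.< ℤ.+0 → z ≢ ℤ.+0)

-- ℓ_b(z) = n : z = Σ_{i=0}^{n-1} uᵢ bⁱ with digits uᵢ ∈ N_b = {0,…,|b|-1}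
-- and leading digit u_{n-1} ≠ 0 (the representation is unique, so this
-- relation determines the length).
HasLength : ℤ → ℤ → ℕ → Set
HasLength b z n =
  Σ (List ℕ) λ vs → Σ ℕ λ u →
    u ≢ 0 × All (ℕ._< ∣ b ∣) (vs ∷ʳ u) ×
    evalDigits b (vs ∷ʳ u) ≡ z × length (vs ∷ʳ u) ≡ n

record IsDigitalSemigroup (b : ℤ) (D : ℤ → Set) : Set where
  field
    nonempty : ∃[ d ] D d
    ⊆Z       : ∀ z → D z → InZ b z
    mul      : ∀ x y → D x → D y → D (x ℤ.* y)
    digital  : ∀ d n → D d → HasLength b d n →
               ∀ z → InZ b z → HasLength b z n → D z

record IsSubmonoid (S : ℕ → Set) : Set where
  field
    zero∈ : S 0
    add   : ∀ m n → S m → S n → S (m ℕ.+ n)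

record IsLDSemigroup (b : ℤ) (S : ℕ → Set) : Set₁ where
  field
    submonoid : IsSubmonoid S
    D         : ℤ → Set
    digitalD  : IsDigitalSemigroup b D
    S≡        : ∀ n → S n → (n ≡ 0 ⊎ ∃[ d ] (D d × HasLength b d n))
    ≡S        : ∀ n → (n ≡ 0 ⊎ ∃[ d ] (D d × HasLength b d n)) → S n

record IsNumericalMonoid (S : ℕ → Set) : Set where
  field
    submonoid : IsSubmonoid S
    cofinite  : ∃[ N ] (∀ n → N ℕ.≤ n → S n)

-- Every element of Z_b has a base-b expansion, so D contains an element of some
-- length k and hence every element of Z_b of length k. If k = 1 then 1 ∈ S. Otherwise
-- the lengths of squares give two coprime elements of S: (b^(k-1))² = b^(2k-2) has
-- length 2k - 1; for b > 0, (bᵏ - 1)² has length 2k, and for b < 0, -b^(k-2) (digits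
-- 0 … 0, |b| - 1, 1) has square of length 2k - 3. A submonoid of ℕ containing m and
-- m + 1 contains every n ≥ m², and the consecutive odd numbers 2j + 1, 2j + 3 yield
-- the consecutive elements j (2j + 3) and (j + 1)(2j + 1).

module Submission where

open import Defs
open import Data.Nat using (ℕ; _≤_)
open import Data.Integer using (ℤ; ∣_∣)

open import Data.Empty using (⊥-elim)
open import Data.List using ([]; _∷_; _∷ʳ_)
open import Data.List.Relation.Unary.All using ([]; _∷_)
open import Data.Product using (∃; _,_; proj₂)
open import Data.Sum using (_⊎_; inj₁; inj₂; [_,_]′)
open import Function using (_∘_; const)
open import Induction.WellFounded using (module All)
open import Data.Nat.Induction using (<-wellFounded)
open import Relation.Binary using (tri<; tri≈; tri>)
import Relation.Binary.Construct.On as On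
open import Relation.Binary.PropositionalEquality
  using (_≡_; _≢_; refl; sym; trans; cong; subst; module ≡-Reasoning)
open import Relation.Nullary using (¬_; yes; no; contradiction)

import Data.Nat as ℕ
import Data.Nat.Properties as ℕₚ
import Data.Nat.Tactic.RingSolver as ℕ-Solver

module _ {S : ℕ → Set} (monoid : IsSubmonoid S) where
  open import Data.Nat using (suc; _+_; _*_; _∸_; _<_)
  open import Data.Nat.DivMod using (_/_; _%_; m≡m%n+[m/n]*n; m%n<n)
  open IsSubmonoid monoid

  *-closed : ∀ t {a} → S a → S (t * a)
  *-closed 0       _  = zero∈
  *-closed (suc t) Sa = add _ _ Sa (*-closed t Sa)

  combination-closed : ∀ s t {a b} → S a → S b → S (s * a + t * b)
  combination-closed s t Sa Sb = add _ _ (*-closed s Sa) (*-closed t Sb)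

  consecutive⇒numerical : ∀ m → S m → S (suc m) → IsNumericalMonoid S
  consecutive⇒numerical m Sm Sm+1 =
    record { submonoid = monoid ; cofinite = m * m , beyond m Sm Sm+1 }
    where
    beyond : ∀ m → S m → S (suc m) → ∀ n → m * m ≤ n → S n
    beyond 0 _ S1 n _ = subst S (ℕₚ.*-identityʳ n) (*-closed n S1)
    beyond m@(suc _) Sm Sm+1 n m*m≤n =
      subst S (sym n≡[q∸r]*m+r*[1+m]) (combination-closed (q ∸ r) r Sm Sm+1)
      where
      open ≡-Reasoning
      q r : ℕ
      q = n / m
      r = n % m
      n≡r+q*m : n ≡ r + q * m
      n≡r+q*m = m≡m%n+[m/n]*n n m
      -- n < (q + 1) m and m² ≤ n force m ≤ q, hence r < m ≤ q.
      m≤q : m ≤ q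
      m≤q = ℕₚ.≤-pred (ℕₚ.*-cancelʳ-< m m (suc q) (ℕₚ.≤-<-trans m*m≤n
              (subst (_< suc q * m) (sym n≡r+q*m) (ℕₚ.+-monoˡ-< (q * m) (m%n<n n m)))))
      rearrange : ∀ r t m → r + (r + t) * m ≡ t * m + r * suc m
      rearrange = ℕ-Solver.solve-∀
      n≡[q∸r]*m+r*[1+m] : n ≡ (q ∸ r) * m + r * suc m
      n≡[q∸r]*m+r*[1+m] = begin
        n                        ≡⟨ n≡r+q*m ⟩
        r + q * m                ≡⟨ cong (λ x → r + x * m) (ℕₚ.m+[n∸m]≡n r≤q) ⟨
        r + (r + (q ∸ r)) * m    ≡⟨ rearrange r (q ∸ r) m ⟩
        (q ∸ r) * m + r * suc m  ∎
        where
        r≤q : r ≤ q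
        r≤q = ℕₚ.≤-trans (ℕₚ.<⇒≤ (m%n<n n m)) m≤q

  consecutive-odd⇒numerical : ∀ j → S (suc (j + j)) → S (suc (suc j + suc j)) → IsNumericalMonoid S
  consecutive-odd⇒numerical j S[2j+1] S[2j+3] =
    consecutive⇒numerical (j * suc (suc j + suc j)) (*-closed j S[2j+3])
      (subst S (product-identity j) (*-closed (suc j) S[2j+1]))
    where
    product-identity : ∀ j → suc j * suc (j + j) ≡ suc (j * suc (suc j + suc j))
    product-identity = ℕ-Solver.solve-∀

m+n≤m*n : ∀ {m n} → 2 ≤ m → 2 ≤ n → m ℕ.+ n ≤ m ℕ.* n
m+n≤m*n {ℕ.suc (ℕ.suc a)} {ℕ.suc (ℕ.suc e)} (ℕ.s≤s (ℕ.s≤s _)) (ℕ.s≤s (ℕ.s≤s _)) =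
  ℕₚ.≤-trans (ℕₚ.m≤m+n _ (a ℕ.+ e ℕ.+ a ℕ.* e)) (ℕₚ.≤-reflexive (sym (expand a e)))
  where
  expand : ∀ a e → (2 ℕ.+ a) ℕ.* (2 ℕ.+ e) ≡ (2 ℕ.+ a) ℕ.+ (2 ℕ.+ e) ℕ.+ (a ℕ.+ e ℕ.+ a ℕ.* e)
  expand = ℕ-Solver.solve-∀

open import Data.Integer as ℤ
  using (+_; +0; -[1+_]; +[1+_]; 0ℤ; 1ℤ; -1ℤ; _+_; _*_; _-_; -_; _^_; _<_; _/_; _%_; +<+; -<+)
open import Data.Integer.Properties
open import Data.Integer.DivMod using (a≡a%n+[a/n]*n; n%d<d; 0≤n⇒0≤n/d)
open import Data.Integer.Tactic.RingSolver using (solve-∀)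

>0⇒InZ : ∀ {b z} → 0ℤ < z → InZ b z
>0⇒InZ 0<z = const 0<z , const (<⇒≢ 0<z ∘ sym)

≢0⇒InZ : ∀ {b z} → b < 0ℤ → z ≢ 0ℤ → InZ b z
≢0⇒InZ b<0 z≢0 = (λ 0<b → contradiction b<0 (<-asym 0<b)) , const z≢0

HasLength-resp : ∀ {b z w n} → z ≡ w → HasLength b z n → HasLength b w n
HasLength-resp refl h = h

¬HasLength-0 : ∀ {b z} → ¬ HasLength b z 0
¬HasLength-0 ([]    , _ , _ , _ , _ , ())
¬HasLength-0 (_ ∷ _ , _ , _ , _ , _ , ())

r+b*0≡r : ∀ b r → + r + b * 0ℤ ≡ + r
r+b*0≡r b r = trans (cong (_+_ (+ r)) (*-zeroʳ b)) (+-identityʳ (+ r))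

HasLength-digit : ∀ b {r} → r ≢ 0 → r ℕ.< ∣ b ∣ → HasLength b (+ r) 1
HasLength-digit b r≢0 r<∣b∣ = [] , _ , r≢0 , r<∣b∣ ∷ [] , r+b*0≡r b _ , refl

HasLength-∷ : ∀ b {z n} r → r ℕ.< ∣ b ∣ → HasLength b z n → HasLength b (+ r + b * z) (ℕ.suc n)
HasLength-∷ b r r<∣b∣ (vs , u , u≢0 , digits , refl , refl) =
  r ∷ vs , u , u≢0 , r<∣b∣ ∷ digits , refl , refl

HasLength-neg-one : ∀ {b} → b < 0ℤ → 2 ≤ ∣ b ∣ → HasLength b -1ℤ 2
HasLength-neg-one {+ _}          (+<+ ()) _
HasLength-neg-one { -[1+ 0 ]}     _        (ℕ.s≤s ())
HasLength-neg-one {b@(-[1+ ℕ.suc p ])} _  2≤∣b∣ =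
  HasLength-resp (value (+ p)) (HasLength-∷ b (ℕ.suc p) ℕₚ.≤-refl (HasLength-digit b (λ ()) 2≤∣b∣))
  where
  value : ∀ P → (+ 1 + P) + (- (+ 2 + P)) * + 1 ≡ -1ℤ
  value = solve-∀

evalDigits-positive : ∀ {b} → 0ℤ < b → ∀ vs {u} → u ≢ 0 → 0ℤ < evalDigits b (vs ∷ʳ u)
evalDigits-positive {b} _   []       {u} u≢0 =
  subst (0ℤ <_) (sym (r+b*0≡r b u)) (+<+ (ℕₚ.n≢0⇒n>0 u≢0))
evalDigits-positive {b} 0<b (v ∷ vs) {u} u≢0 = begin-strict
  0ℤ           ≡⟨ *-zeroʳ b ⟨
  b * 0ℤ       <⟨ *-monoˡ-<-pos b {{ℤ.positive 0<b}} (evalDigits-positive 0<b vs u≢0) ⟩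
  b * e        ≤⟨ i≤j+i (b * e) (+ v) ⟩
  + v + b * e  ∎
  where
  open ≤-Reasoning
  e : ℤ
  e = evalDigits b (vs ∷ʳ u)

HasLength⇒positive : ∀ {b z n} → 0ℤ < b → HasLength b z n → 0ℤ < z
HasLength⇒positive 0<b (vs , _ , u≢0 , _ , refl , _) = evalDigits-positive 0<b vs u≢0

module Base {b : ℤ} (2≤∣b∣ : 2 ≤ ∣ b ∣) where

  private
    0<∣b∣ : 0 ℕ.< ∣ b ∣
    0<∣b∣ = ℕₚ.<-trans (ℕ.s≤s ℕ.z≤n) 2≤∣b∣

    instance
      b-nonZero : ℤ.NonZero b
      b-nonZero = ℕ.>-nonZero 0<∣b∣

  sign : b < 0ℤ ⊎ 0ℤ < b
  sign with <-cmp b 0ℤ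
  ... | tri< b<0 _ _ = inj₁ b<0
  ... | tri≈ _ b≡0 _ = contradiction (subst (λ x → 2 ≤ ∣ x ∣) b≡0 2≤∣b∣) λ ()
  ... | tri> _ _ 0<b = inj₂ 0<b

  InZ⇒≢0 : ∀ {z} → InZ b z → z ≢ 0ℤ
  InZ⇒≢0 (positive , nonzero) refl with sign
  ... | inj₁ b<0 = nonzero b<0 refl
  ... | inj₂ 0<b = <-irrefl refl (positive 0<b)

  InZ-negative⇒b<0 : ∀ {z} → InZ b z → z < 0ℤ → b < 0ℤ
  InZ-negative⇒b<0 (positive , _) z<0 with sign
  ... | inj₁ b<0 = b<0
  ... | inj₂ 0<b = contradiction z<0 (<-asym (positive 0<b))

  HasLength-^ : ∀ j → HasLength b (b ^ j) (ℕ.suc j)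
  HasLength-^ ℕ.zero    = HasLength-digit b (λ ()) 2≤∣b∣
  HasLength-^ (ℕ.suc j) = HasLength-resp (+-identityˡ _) (HasLength-∷ b 0 0<∣b∣ (HasLength-^ j))

  HasLength-^-square : ∀ j → HasLength b (b ^ j * b ^ j) (ℕ.suc (j ℕ.+ j))
  HasLength-^-square j = HasLength-resp (^-distribˡ-+-* b j j) (HasLength-^ (j ℕ.+ j))

  HasLength-shift : ∀ {z n} j → HasLength b z n → HasLength b (b ^ j * z) (j ℕ.+ n)
  HasLength-shift       ℕ.zero    h = HasLength-resp (sym (*-identityˡ _)) h
  HasLength-shift {z} (ℕ.suc j) h =
    HasLength-resp (trans (+-identityˡ _) (sym (*-assoc b (b ^ j) z)))
      (HasLength-∷ b 0 0<∣b∣ (HasLength-shift j h))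

  z≡r+b*q : ∀ z → z ≡ + (z % b) + b * (z / b)
  z≡r+b*q z = trans (a≡a%n+[a/n]*n z b) (cong (_+_ (+ (z % b))) (*-comm (z / b) b))

  InZ-/ : ∀ {z} → InZ b z → z / b ≢ 0ℤ → InZ b (z / b)
  InZ-/ {z} (positive , _) q≢0 =
    (λ 0<b → ≤∧≢⇒< (0≤n⇒0≤n/d z b (<⇒≤ (positive 0<b)) (<⇒≤ 0<b)) (q≢0 ∘ sym)) , const q≢0

  ∣z/b∣<∣z∣ : ∀ z → 2 ≤ ∣ z ∣ → ∣ z / b ∣ ℕ.< ∣ z ∣
  ∣z/b∣<∣z∣ z 2≤∣z∣ = ℕₚ.*-cancelʳ-< ∣ b ∣ _ _ (begin-strict
    ∣ q ∣ ℕ.* ∣ b ∣  ≡⟨ abs-* q b ⟨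
    ∣ q * b ∣        ≡⟨ cong ∣_∣ q*b≡z-r ⟩
    ∣ z - + r ∣      ≤⟨ ∣i-j∣≤∣i∣+∣j∣ z (+ r) ⟩
    ∣ z ∣ ℕ.+ r      <⟨ ℕₚ.+-monoʳ-< ∣ z ∣ (n%d<d z b) ⟩
    ∣ z ∣ ℕ.+ ∣ b ∣  ≤⟨ m+n≤m*n 2≤∣z∣ 2≤∣b∣ ⟩
    ∣ z ∣ ℕ.* ∣ b ∣  ∎)
    where
    open ℕₚ.≤-Reasoning
    q : ℤ
    q = z / b
    r : ℕ
    r = z % b
    cancel : ∀ r x → x ≡ (r + x) - r
    cancel = solve-∀
    q*b≡z-r : q * b ≡ z - + r
    q*b≡z-r = trans (cancel (+ r) (q * b)) (cong (_- + r) (sym (a≡a%n+[a/n]*n z b)))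

  length-exists : ∀ {z} → InZ b z → ∃ (HasLength b z)
  length-exists {z} = All.wfRec (On.wellFounded ∣_∣ <-wellFounded) _
                        (λ z → InZ b z → ∃ (HasLength b z)) step z
    where
    Hyp : ℤ → Set
    Hyp z = ∀ {w} → ∣ w ∣ ℕ.< ∣ z ∣ → InZ b w → ∃ (HasLength b w)

    divide : ∀ z → 2 ≤ ∣ z ∣ → Hyp z → InZ b z → ∃ (HasLength b z)
    divide z 2≤∣z∣ rec z∈Z with z / b ℤ.≟ 0ℤ
    ... | yes q≡0 = 1 , HasLength-resp (sym z≡r) (HasLength-digit b r≢0 (n%d<d z b))
      where
      z≡r : z ≡ + (z % b)
      z≡r = trans (z≡r+b*q z) (trans (cong (λ q → + (z % b) + b * q) q≡0) (r+b*0≡r b _))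
      r≢0 : z % b ≢ 0
      r≢0 r≡0 = InZ⇒≢0 z∈Z (trans z≡r (cong +_ r≡0))
    ... | no q≢0 with rec (∣z/b∣<∣z∣ z 2≤∣z∣) (InZ-/ z∈Z q≢0)
    ...   | n , h = ℕ.suc n , HasLength-resp (sym (z≡r+b*q z)) (HasLength-∷ b _ (n%d<d z b) h)

    -- For ∣z∣ = 1 division need not shrink ∣z∣ (in a negative base -1 = (∣b∣ - 1) + b · 1),
    -- so ±1 are base cases.
    step : ∀ z → Hyp z → InZ b z → ∃ (HasLength b z)
    step +0                    _   z∈Z = contradiction refl (InZ⇒≢0 z∈Z)
    step +[1+ 0 ]              _   _   = 1 , HasLength-digit b (λ ()) 2≤∣b∣
    step -[1+ 0 ]              _   z∈Z = 2 , HasLength-neg-one (InZ-negative⇒b<0 z∈Z -<+) 2≤∣b∣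
    step z@(+[1+ ℕ.suc _ ])    rec z∈Z = divide z (ℕ.s≤s (ℕ.s≤s ℕ.z≤n)) rec z∈Z
    step z@(-[1+ ℕ.suc _ ])    rec z∈Z = divide z (ℕ.s≤s (ℕ.s≤s ℕ.z≤n)) rec z∈Z

module PositiveBase (c : ℕ) where

  b : ℤ
  b = + (2 ℕ.+ c)

  open Base {b} (ℕ.s≤s (ℕ.s≤s ℕ.z≤n)) public

  HasLength⇒InZ : ∀ {z n} → HasLength b z n → InZ b z
  HasLength⇒InZ = >0⇒InZ ∘ HasLength⇒positive (+<+ (ℕ.s≤s ℕ.z≤n))

  HasLength-^-minus-1 : ∀ n → HasLength b (b ^ ℕ.suc n - 1ℤ) (ℕ.suc n)
  HasLength-^-minus-1 ℕ.zero    =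
    HasLength-resp (sym (cong (_- 1ℤ) (*-identityʳ b))) (HasLength-digit b (λ ()) ℕₚ.≤-refl)
  HasLength-^-minus-1 (ℕ.suc n) =
    HasLength-resp (step (+ c) (b ^ ℕ.suc n)) (HasLength-∷ b (ℕ.suc c) ℕₚ.≤-refl (HasLength-^-minus-1 n))
    where
    step : ∀ C P → (+ 1 + C) + (+ 2 + C) * (P - 1ℤ) ≡ (+ 2 + C) * P - 1ℤ
    step = solve-∀

  -- (bᵏ - 1)² = 1 + b · bᵏ⁻¹ · ((b - 2) + b (bᵏ⁻¹ - 1)): the digits are 1, then k - 1
  -- zeros, then b - 2, then k - 1 digits b - 1.
  HasLength-^-minus-1-square : ∀ i → let k = 2 ℕ.+ i in
                         HasLength b ((b ^ k - 1ℤ) * (b ^ k - 1ℤ)) (k ℕ.+ k)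
  HasLength-^-minus-1-square i =
    HasLength-resp (sym (expand (+ c) (b ^ ℕ.suc i)))
      (HasLength-∷ b 1 (ℕ.s≤s (ℕ.s≤s ℕ.z≤n))
        (HasLength-shift (ℕ.suc i)
          (HasLength-∷ b c (ℕₚ.m<n+m c (ℕ.s≤s ℕ.z≤n)) (HasLength-^-minus-1 i))))
    where
    expand : ∀ C P → ((+ 2 + C) * P - 1ℤ) * ((+ 2 + C) * P - 1ℤ)
                     ≡ + 1 + (+ 2 + C) * (P * (C + (+ 2 + C) * (P - 1ℤ)))
    expand = solve-∀

module NegativeBase (p : ℕ) where

  b : ℤ
  b = -[1+ ℕ.suc p ]

  open Base {b} (ℕ.s≤s (ℕ.s≤s ℕ.z≤n)) public

  ^≢0 : ∀ j → b ^ j ≢ 0ℤ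
  ^≢0 j = (λ ()) ∘ i^n≡0⇒i≡0 b j

  HasLength-neg-^ : ∀ i → HasLength b (b ^ i * -1ℤ) (2 ℕ.+ i)
  HasLength-neg-^ i = subst (HasLength b _) (ℕₚ.+-comm i 2)
                        (HasLength-shift i (HasLength-neg-one -<+ (ℕ.s≤s (ℕ.s≤s ℕ.z≤n))))

  neg-^≢0 : ∀ i → b ^ i * -1ℤ ≢ 0ℤ
  neg-^≢0 i = [ ^≢0 i , (λ ()) ]′ ∘ i*j≡0⇒i≡0∨j≡0 (b ^ i)

  HasLength-neg-^-square : ∀ i → HasLength b ((b ^ i * -1ℤ) * (b ^ i * -1ℤ)) (ℕ.suc (i ℕ.+ i))
  HasLength-neg-^-square i = HasLength-resp (square (b ^ i)) (HasLength-^-square i)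
    where
    square : ∀ P → P * P ≡ (P * -1ℤ) * (P * -1ℤ)
    square = solve-∀

module LDSemigroup {b : ℤ} {S : ℕ → Set} (ld : IsLDSemigroup b S) where
  open IsLDSemigroup ld public
  open IsDigitalSemigroup digitalD public

  length∈S : ∀ {z n} → D z → HasLength b z n → S n
  length∈S Dz hz = ≡S _ (inj₂ (_ , Dz , hz))

  square-length∈S : ∀ {d k z n} → D d → HasLength b d k → InZ b z → HasLength b z k →
                    HasLength b (z * z) n → S n
  square-length∈S Dd hd z∈Z hz hzz = length∈S (mul _ _ Dz Dz) hzz
    where
    Dz : D _
    Dz = digital _ _ Dd hd _ z∈Z hz

positive-base⇒numerical : ∀ c {S} (ld : IsLDSemigroup (+ (2 ℕ.+ c)) S) →
                          ∀ {d} i → IsLDSemigroup.D ld d → HasLength (+ (2 ℕ.+ c)) d (2 ℕ.+ i) →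
                          IsNumericalMonoid S
positive-base⇒numerical c {S} ld i Dd hd =
  consecutive⇒numerical submonoid (ℕ.suc (ℕ.suc i ℕ.+ ℕ.suc i)) S[2i+3]
    (subst S (cong (ℕ.suc ∘ ℕ.suc) (ℕₚ.+-suc i (ℕ.suc i))) S[2i+4])
  where
  open LDSemigroup ld
  open PositiveBase c
  S[2i+3] : S (ℕ.suc (ℕ.suc i ℕ.+ ℕ.suc i))
  S[2i+3] = square-length∈S Dd hd (HasLength⇒InZ (HasLength-^ (ℕ.suc i))) (HasLength-^ (ℕ.suc i))
              (HasLength-^-square (ℕ.suc i))
  S[2i+4] : S ((2 ℕ.+ i) ℕ.+ (2 ℕ.+ i))
  S[2i+4] = square-length∈S Dd hd (HasLength⇒InZ (HasLength-^-minus-1 (ℕ.suc i))) (HasLength-^-minus-1 (ℕ.suc i))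
              (HasLength-^-minus-1-square i)

negative-base⇒numerical : ∀ p {S} (ld : IsLDSemigroup -[1+ ℕ.suc p ] S) →
                          ∀ {d} i → IsLDSemigroup.D ld d → HasLength -[1+ ℕ.suc p ] d (2 ℕ.+ i) →
                          IsNumericalMonoid S
negative-base⇒numerical p {S} ld i Dd hd = consecutive-odd⇒numerical submonoid i S[2i+1] S[2i+3]
  where
  open LDSemigroup ld
  open NegativeBase p
  S[2i+1] : S (ℕ.suc (i ℕ.+ i))
  S[2i+1] = square-length∈S Dd hd (≢0⇒InZ -<+ (neg-^≢0 i)) (HasLength-neg-^ i) (HasLength-neg-^-square i)
  S[2i+3] : S (ℕ.suc (ℕ.suc i ℕ.+ ℕ.suc i))
  S[2i+3] = square-length∈S Dd hd (≢0⇒InZ -<+ (^≢0 (ℕ.suc i))) (HasLength-^ (ℕ.suc i))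
              (HasLength-^-square (ℕ.suc i))

LD⇒numerical : ∀ {b S} (ld : IsLDSemigroup b S) → 2 ≤ ∣ b ∣ →
               ∀ {d k} → IsLDSemigroup.D ld d → HasLength b d k → IsNumericalMonoid S
LD⇒numerical ld _ {k = 0} _ hd = ⊥-elim (¬HasLength-0 hd)
LD⇒numerical ld _ {k = 1} Dd hd =
  consecutive⇒numerical submonoid 0 (IsSubmonoid.zero∈ submonoid) (length∈S Dd hd)
  where open LDSemigroup ld
LD⇒numerical {+ ℕ.suc (ℕ.suc c)} ld _ {k = ℕ.suc (ℕ.suc i)} = positive-base⇒numerical c ld i
LD⇒numerical { -[1+ ℕ.suc p ]}   ld _ {k = ℕ.suc (ℕ.suc i)} = negative-base⇒numerical p ld i
LD⇒numerical {+0}         _ ()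
LD⇒numerical {+[1+ 0 ]}   _ (ℕ.s≤s ())
LD⇒numerical { -[1+ 0 ]}  _ (ℕ.s≤s ())

corollary2p4 : (b : ℤ) → 2 ≤ ∣ b ∣ → (S : ℕ → Set) →
                 IsLDSemigroup b S → IsNumericalMonoid S
corollary2p4 b 2≤∣b∣ S ld with LDSemigroup.nonempty ld
... | d , Dd = LD⇒numerical ld 2≤∣b∣ Dd (proj₂ (Base.length-exists 2≤∣b∣ (⊆Z d Dd)))
  where open LDSemigroup ld
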